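{- For every computably bounded numbering $\phi$, there is no unbounded computable function $h$ such that $\min_\phi(e)\ge h(e)$ for all $e$.
   Context: A numbering $\phi$ is given by a partial-recursive function $U:\mathbb{N}^2\to\mathbb{N}$ via $\phi_e(x)=U(e,x)$. $\phi$ is computably bounded if for every numbering $\psi$ there is a computable $f$ such that for every $e$ some $j\le f(e)$ has $\phi_j=\psi_e$. $\mathrm{MIN}_\phi=\{e:(\forall j<e)\,[\phi_j\ne\phi_e]\}$ and $\min_\phi(e)$ is the unique $j\in\mathrm{MIN}_\phi$ with $\phi_j=\phi_e$. -}

module Defs where

open import Data.Nat using (ℕ; zero; suc; _≤_; _<_)
open import Data.Vec using (Vec; []; _∷_; lookup)
open import Data.Fin using (Fin)
open import Data.Product using (Σ; ∃; _×_; _,_)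
open import Relation.Nullary using (¬_)

data PR : ℕ → Set where
  zer  : PR 0
  succ : PR 1
  proj : ∀ {n} → Fin n → PR n
  comp : ∀ {m n} → PR m → Vec (PR n) m → PR n
  prec : ∀ {n} → PR n → PR (suc (suc n)) → PR (suc n)
  mu   : ∀ {n} → PR (suc n) → PR n

mutual
  data Eval : ∀ {n} → PR n → Vec ℕ n → ℕ → Set where
    ev-zer  : Eval zer [] 0
    ev-succ : ∀ {x} → Eval succ (x ∷ []) (suc x)
    ev-proj : ∀ {n} {i : Fin n} {xs} → Eval (proj i) xs (lookup xs i)
    ev-comp : ∀ {m n} {f : PR m} {gs : Vec (PR n) m} {xs ys v} →
              EvalV gs xs ys → Eval f ys v → Eval (comp f gs) xs v
    ev-prec0 : ∀ {n} {g : PR n} {h} {xs v} →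
               Eval g xs v → Eval (prec g h) (0 ∷ xs) v
    ev-precS : ∀ {n} {g : PR n} {h} {k xs r v} →
               Eval (prec g h) (k ∷ xs) r → Eval h (k ∷ r ∷ xs) v →
               Eval (prec g h) (suc k ∷ xs) v
    ev-mu   : ∀ {n} {f : PR (suc n)} {xs k} →
              Eval f (k ∷ xs) 0 →
              (∀ m → m < k → ∃ λ r → Eval f (m ∷ xs) (suc r)) →
              Eval (mu f) xs k

  data EvalV : ∀ {m n} → Vec (PR n) m → Vec ℕ n → Vec ℕ m → Set where
    evV-[] : ∀ {n} {xs : Vec ℕ n} → EvalV [] xs []
    evV-∷  : ∀ {m n} {g : PR n} {gs : Vec (PR n) m} {xs y ys} →
             Eval g xs y → EvalV gs xs ys → EvalV (g ∷ gs) xs (y ∷ ys)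

Computable : (ℕ → ℕ) → Set
Computable f = Σ (PR 1) λ c → ∀ x → Eval c (x ∷ []) (f x)

-- A numbering is given by a partial recursive U : ℕ² ⇀ ℕ, φ_e(x) = U(e,x).
Numbering : Set
Numbering = PR 2

_⟨_⟩_↓_ : Numbering → ℕ → ℕ → ℕ → Set
φ ⟨ e ⟩ x ↓ v = Eval φ (e ∷ x ∷ []) v

SameFn : Numbering → ℕ → Numbering → ℕ → Set
SameFn φ i ψ j = ∀ x v → (φ ⟨ i ⟩ x ↓ v → ψ ⟨ j ⟩ x ↓ v) × (ψ ⟨ j ⟩ x ↓ v → φ ⟨ i ⟩ x ↓ v)

ComputablyBounded : Numbering → Set
ComputablyBounded φ =
  ∀ (ψ : Numbering) → Σ (ℕ → ℕ) λ f → Computable f ×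
    (∀ e → ∃ λ j → j ≤ f e × SameFn φ j ψ e)

MIN : Numbering → ℕ → Set
MIN φ e = ∀ j → j < e → ¬ SameFn φ j φ e

-- IsMin φ e j  :  j = min_φ(e), i.e. j ∈ MIN_φ and φ_j = φ_e
IsMin : Numbering → ℕ → ℕ → Set
IsMin φ e j = MIN φ j × SameFn φ j φ e

Unbounded : (ℕ → ℕ) → Set
Unbounded h = ∀ n → ∃ λ e → n ≤ h e

module Submission where

-- Suppose φ is computably bounded and h is a computable,
-- unbounded function with h(e) ≤ min_φ(e) for all e.  Then h(e) ≤ i for every
-- φ-index i of φ_e.  Let a(j) = μx. h(x) > φ_j(j), and let ψ_j = φ_{a(j)}.
-- Computable boundedness for ψ yields a computable f such that every ψ_j has a
-- φ-index ≤ f(j); applied once more (to the numbering whose every member is f)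
-- it yields a φ-index j of f itself.  Then φ_j(j) = f(j), so k = a(j) is the
-- least x with h(x) > f(j), and ψ_j = φ_k has a φ-index j' ≤ f(j).  Hence
-- f(j) < h(k) ≤ j' ≤ f(j), a contradiction.

open import Defs
open import Data.Nat using (ℕ; zero; suc; pred; _∸_; _≤_; _<_; _≤?_)
open import Data.Nat.Properties
  using (≤-refl; ≤-trans; ≤-pred; <-≤-trans; <-cmp; <-irrefl; ≮⇒≥;
         pred[m∸n]≡m∸[1+n]; m≤n⇒m∸n≡0; +-∸-assoc)
open import Data.Product using (Σ; ∃; _×_; _,_; proj₁; proj₂)
open import Data.Vec using (Vec; []; _∷_)
open import Data.Fin using (zero; suc)
open import Relation.Nullary using (¬_)
open import Relation.Nullary.Decidable using (decidable-stable)
open import Relation.Binary using (tri<; tri≈; tri>)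
open import Relation.Binary.PropositionalEquality using (_≡_; refl; subst)

-- Evaluation is deterministic: a code has at most one value on each input.
-- Needed to read off the value of the μ-search a(j) inside ψ_j = φ_{a(j)}.
mutual
  eval-det : ∀ {n} {c : PR n} {xs u v} → Eval c xs u → Eval c xs v → u ≡ v
  eval-det ev-zer ev-zer = refl
  eval-det ev-succ ev-succ = refl
  eval-det ev-proj ev-proj = refl
  eval-det (ev-comp gs f) (ev-comp gs′ f′) with evalV-det gs gs′
  ... | refl = eval-det f f′
  eval-det (ev-prec0 g) (ev-prec0 g′) = eval-det g g′
  eval-det (ev-precS r h) (ev-precS r′ h′) with eval-det r r′
  ... | refl = eval-det h h′
  eval-det {u = k} {v = k′} (ev-mu zero-at-k pos-below-k) (ev-mu zero-at-k′ pos-below-k′)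
    with <-cmp k k′
  ... | tri≈ _ k≡k′ _ = k≡k′
  ... | tri< k<k′ _ _ with pos-below-k′ k k<k′
  ...   | _ , pos with eval-det zero-at-k pos
  ...     | ()
  eval-det (ev-mu zero-at-k pos-below-k) (ev-mu zero-at-k′ pos-below-k′)
      | tri> _ _ k′<k with pos-below-k _ k′<k
  ...   | _ , pos with eval-det zero-at-k′ pos
  ...     | ()

  evalV-det : ∀ {m n} {gs : Vec (PR n) m} {xs ys zs} →
              EvalV gs xs ys → EvalV gs xs zs → ys ≡ zs
  evalV-det evV-[] evV-[] = refl
  evalV-det (evV-∷ g gs) (evV-∷ g′ gs′) with eval-det g g′ | evalV-det gs gs′
  ... | refl | refl = refl

SameFn-trans : ∀ φ i ψ j χ k → SameFn φ i ψ j → SameFn ψ j χ k → SameFn φ i χ k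
SameFn-trans φ i ψ j χ k s t x v =
  (λ e → proj₁ (t x v) (proj₁ (s x v) e)) , (λ e → proj₂ (s x v) (proj₂ (t x v) e))

Least : (ℕ → Set) → ℕ → Set
Least P k = P k × (∀ i → i < k → ¬ P i)

-- Least-number principle for an arbitrary (not necessarily decidable) predicate,
-- in double-negated form: a witness cannot coexist with the absence of a least one.
¬¬-least : (P : ℕ → Set) {n : ℕ} → P n → ¬ ¬ ∃ (Least P)
¬¬-least P {n} pn noLeast = noneBelow (suc n) n ≤-refl pn
  where
  noneBelow : ∀ b m → m < b → ¬ P m
  noneBelow (suc b) m m<1+b pm =
    noLeast (m , pm , λ i i<m → noneBelow b i (≤-trans i<m (≤-pred m<1+b)))

-- If h lies below min_φ, it lies below every φ-index of φ_e: the least index i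
-- with φ_i = φ_e is min_φ(e), and it is at most any other such index.
index-lower-bound : (φ : Numbering) (h : ℕ → ℕ) →
  (∀ e j → IsMin φ e j → h e ≤ j) → ∀ e i → SameFn φ i φ e → h e ≤ i
index-lower-bound φ h h≤min e i φi=φe = decidable-stable (h e ≤? i) λ h≰i →
  ¬¬-least (λ m → SameFn φ m φ e) φi=φe λ where
    (m , φm=φe , noneBelow) →
      let m-is-min : IsMin φ e m
          m-is-min = (λ l l<m φl=φm → noneBelow l l<m (SameFn-trans φ l φ m φ e φl=φm φm=φe))
                   , φm=φe
          m≤i = ≮⇒≥ (λ i<m → noneBelow i i<m φi=φe)
      in h≰i (≤-trans (h≤min e m m-is-min) m≤i)

-- In a computably bounded numbering every total computable function has an
-- index: bound the numbering all of whose members equal f.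
computable-has-index : (φ : Numbering) → ComputablyBounded φ →
  ∀ {f} → Computable f → ∃ λ j → ∀ x → φ ⟨ j ⟩ x ↓ f x
computable-has-index φ cb {f} (cf , cf-computes) =
  let (_ , _ , bound) = cb constantly-f
      (j , _ , φj=f) = bound 0
  in j , λ x → proj₂ (φj=f x (f x)) (ev-comp (evV-∷ ev-proj evV-[]) (cf-computes x))
  where
  constantly-f : Numbering
  constantly-f = comp cf (proj (suc zero) ∷ [])

predCode : PR 1
predCode = prec zer (proj zero)

eval-pred : ∀ n → Eval predCode (n ∷ []) (pred n)
eval-pred zero = ev-prec0 ev-zer
eval-pred (suc n) = ev-precS (eval-pred n) ev-proj

monusCode : PR 2
monusCode = prec (proj zero) (comp predCode (proj (suc zero) ∷ []))

eval-monus : ∀ k a → Eval monusCode (k ∷ a ∷ []) (a ∸ k)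
eval-monus zero a = ev-prec0 ev-proj
eval-monus (suc k) a = subst (Eval monusCode (suc k ∷ a ∷ [])) (pred[m∸n]≡m∸[1+n] a k)
  (ev-precS (eval-monus k a) (ev-comp (evV-∷ ev-proj evV-[]) (eval-pred (a ∸ k))))

-- gap(x, j) = (φ_j(j) + 1) ∸ h(x), which vanishes exactly when h(x) > φ_j(j).
gapCode : Numbering → PR 1 → PR 2
gapCode φ ch = comp monusCode
  ( comp ch (proj zero ∷ [])
  ∷ comp succ (comp φ (proj (suc zero) ∷ proj (suc zero) ∷ []) ∷ [])
  ∷ [])

eval-gap : ∀ φ ch {h : ℕ → ℕ} → (∀ x → Eval ch (x ∷ []) (h x)) →
  ∀ {j v} → φ ⟨ j ⟩ j ↓ v → ∀ x → Eval (gapCode φ ch) (x ∷ j ∷ []) (suc v ∸ h x)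
eval-gap φ ch {h} ch-computes {v = v} φjj x =
  ev-comp (evV-∷ (ev-comp (evV-∷ ev-proj evV-[]) (ch-computes x))
          (evV-∷ (ev-comp (evV-∷ (ev-comp (evV-∷ ev-proj (evV-∷ ev-proj evV-[])) φjj) evV-[])
                          ev-succ)
           evV-[]))
          (eval-monus (h x) (suc v))

firstAboveCode : Numbering → PR 1 → PR 1
firstAboveCode φ ch = mu (gapCode φ ch)

eval-firstAbove : ∀ φ ch {h : ℕ → ℕ} → (∀ x → Eval ch (x ∷ []) (h x)) →
  ∀ {j v k} → φ ⟨ j ⟩ j ↓ v → Least (λ x → v < h x) k →
  Eval (firstAboveCode φ ch) (j ∷ []) k
eval-firstAbove φ ch {h} ch-computes {j} {v} {k} φjj (v<hk , noneBelow) =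
  ev-mu (subst (Eval (gapCode φ ch) (k ∷ j ∷ [])) (m≤n⇒m∸n≡0 v<hk) (gap k))
        (λ m m<k → v ∸ h m ,
          subst (Eval (gapCode φ ch) (m ∷ j ∷ [])) (+-∸-assoc 1 (≮⇒≥ (noneBelow m m<k))) (gap m))
  where
  gap = eval-gap φ ch ch-computes φjj

reindex : Numbering → PR 1 → Numbering
reindex φ a = comp φ (comp a (proj zero ∷ []) ∷ proj (suc zero) ∷ [])

reindex-index : ∀ φ a {j k} → Eval a (j ∷ []) k → SameFn (reindex φ a) j φ k
reindex-index φ a aj=k x v = to , from
  where
  to : reindex φ a ⟨ _ ⟩ x ↓ v → φ ⟨ _ ⟩ x ↓ v
  to (ev-comp (evV-∷ (ev-comp (evV-∷ ev-proj evV-[]) aj) (evV-∷ ev-proj evV-[])) φ-eval)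
    with eval-det aj aj=k
  ... | refl = φ-eval
  from : φ ⟨ _ ⟩ x ↓ v → reindex φ a ⟨ _ ⟩ x ↓ v
  from φ-eval = ev-comp (evV-∷ (ev-comp (evV-∷ ev-proj evV-[]) aj=k) (evV-∷ ev-proj evV-[])) φ-eval

proposition4p2 : (φ : Numbering) → ComputablyBounded φ →
    ¬ (Σ (ℕ → ℕ) λ h → Computable h × Unbounded h × (∀ e j → IsMin φ e j → h e ≤ j))
proposition4p2 φ cb (h , (ch , ch-computes) , unbounded , h≤min) =
  ¬¬-least (λ x → f j < h x) (proj₂ (unbounded (suc (f j)))) λ where
    (k , fj<hk , noneBelow) →
      let aj=k = eval-firstAbove φ ch ch-computes φjj (fj<hk , noneBelow)
          (j′ , j′≤fj , φj′=ψj) = ψ-bound j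
          φj′=φk = SameFn-trans φ j′ ψ j φ k φj′=ψj (reindex-index φ a aj=k)
          hk≤j′ = index-lower-bound φ h h≤min k j′ φj′=φk
      in <-irrefl refl (<-≤-trans fj<hk (≤-trans hk≤j′ j′≤fj))
  where
  a : PR 1
  a = firstAboveCode φ ch
  ψ : Numbering
  ψ = reindex φ a
  f : ℕ → ℕ
  f = proj₁ (cb ψ)
  ψ-bound : ∀ e → ∃ λ j′ → j′ ≤ f e × SameFn φ j′ ψ e
  ψ-bound = proj₂ (proj₂ (cb ψ))
  f-index : ∃ λ j → ∀ x → φ ⟨ j ⟩ x ↓ f x
  f-index = computable-has-index φ cb (proj₁ (proj₂ (cb ψ)))
  j : ℕ
  j = proj₁ f-index
  φjj : φ ⟨ j ⟩ j ↓ f j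
  φjj = proj₂ f-index j
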